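{- Let $\Delta_1,\Delta_2,\Delta_3$ be meta-formulae and $A$, $C$ formulae of $\boldsymbol{!}_\mathbf{b}\mathbf{L}^{\mathbf{1}}$. If $\boldsymbol{!}_\mathbf{b}\mathbf{L}^{\mathbf{1}}\vdash \Delta_1, !\,[]^{ -1}A, \Delta_2, A, \Delta_3 \to C$, then $\boldsymbol{!}_\mathbf{b}\mathbf{L}^{\mathbf{1}}\vdash \Delta_1, !\,[]^{ -1}A, \Delta_2, \Delta_3 \to C$ (i.e., the rule $(\mathrm{inst})$ deriving the latter from the former is admissible).
   Context: The calculus $\boldsymbol{!}_\mathbf{b}\mathbf{L}^{\mathbf{1}}$: formulae are built from variables $p_1,p_2,\dots$ and the constant $\mathbf{1}$ using binary $\backslash$, $/$, $\cdot$ and unary $\langle\rangle$, $[]^{ -1}$, $!$. Meta-formulae are finite (possibly empty, empty one denoted $\Lambda$) sequences whose elements are formulae or bracketed meta-formulae $[\Pi]$; comma is concatenation; $\Delta(\Gamma)$ denotes $\Delta$ with a designated occurrence of a meta-formula $\Gamma$ (consecutive elements at some bracket depth). Sequents are $\Pi\to A$. Axioms: $A\to A$, $\Lambda\to\mathbf{1}$. Rules (premises $\Rightarrow$ conclusion): $(/\to)$: $\Gamma\to B$, $\Delta(C)\to D$ $\Rightarrow$ $\Delta(C/B,\Gamma)\to D$; $(\to/)$: $\Gamma,B\to C$ $\Rightarrow$ $\Gamma\to C/B$; $(\backslash\to)$: $\Gamma\to A$, $\Delta(C)\to D$ $\Rightarrow$ $\Delta(\Gamma,A\backslash C)\to D$;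 $(\to\backslash)$: $A,\Gamma\to C$ $\Rightarrow$ $\Gamma\to A\backslash C$; $(\cdot\to)$: $\Delta(A,B)\to D$ $\Rightarrow$ $\Delta(A\cdot B)\to D$; $(\to\cdot)$: $\Gamma_1\to A$, $\Gamma_2\to B$ $\Rightarrow$ $\Gamma_1,\Gamma_2\to A\cdot B$; $(\mathbf{1}\to)$: $\Delta(\Lambda)\to A$ $\Rightarrow$ $\Delta(\mathbf{1})\to A$; $(\langle\rangle\to)$: $\Delta([A])\to C$ $\Rightarrow$ $\Delta(\langle\rangle A)\to C$; $(\to\langle\rangle)$: $\Pi\to A$ $\Rightarrow$ $[\Pi]\to\langle\rangle A$; $([]^{ -1}\to)$: $\Delta(A)\to C$ $\Rightarrow$ $\Delta([[]^{ -1}A])\to C$; $(\to[]^{ -1})$: $[\Pi]\to A$ $\Rightarrow$ $\Pi\to[]^{ -1}A$; $(!\to)$: $\Gamma(A)\to B$ $\Rightarrow$ $\Gamma(!A)\to B$; $(\to!)$: $!A_1,\dots,!A_n\to A$ $\Rightarrow$ $!A_1,\dots,!A_n\to!A$; $(\mathrm{contr}_\mathbf{b})$: $\Delta(!A_1,\dots,!A_n,[!A_1,\dots,!A_n,\Gamma])\to B$ $\Rightarrow$ $\Delta(!A_1,\dots,!A_n,\Gamma)\to B$ ($n\ge1$); $(\mathrm{perm}_1)$: $\Delta(!A,\Gamma)\to B$ $\Rightarrow$ $\Delta(\Gamma,!A)\to B$; $(\mathrm{perm}_2)$: $\Delta(\Gamma,!A)\to B$ $\Rightarrow$ $\Delta(!A,\Gamma)\to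 B$; $(\mathrm{cut})$: $\Pi\to A$, $\Delta(A)\to C$ $\Rightarrow$ $\Delta(\Pi)\to C$. -}

module Defs where

open import Data.Nat using (ℕ)
open import Data.List using (List; []; _∷_; _++_; map; [_])

data Fm : Set where
  var   : ℕ → Fm
  𝟏     : Fm
  _＼_  : Fm → Fm → Fm
  _／_  : Fm → Fm → Fm
  _·_   : Fm → Fm → Fm
  ⟨⟩_   : Fm → Fm
  []⁻¹_ : Fm → Fm
  !_    : Fm → Fm

mutual
  MF : Set
  MF = List El

  data El : Set where
    fm : Fm → El
    br : MF → El

Λ : MF
Λ = []

-- A context Δ(_) with one designated hole at some bracket depth.
data Ctx : Set where
  hole : MF → MF → Ctx
  inBr : MF → Ctx → MF → Ctx

_⟦_⟧ : Ctx → MF → MF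
hole L R   ⟦ Γ ⟧ = L ++ Γ ++ R
inBr L c R ⟦ Γ ⟧ = L ++ br (c ⟦ Γ ⟧) ∷ R

bangs : List Fm → MF
bangs As = map (λ A → fm (! A)) As

infix 4 _⊢_
data _⊢_ : MF → Fm → Set where
  ax     : ∀ {A} → [ fm A ] ⊢ A
  ax𝟏    : Λ ⊢ 𝟏
  /L     : ∀ {Γ B Δ C D} → Γ ⊢ B → Δ ⟦ [ fm C ] ⟧ ⊢ D →
           Δ ⟦ fm (C ／ B) ∷ Γ ⟧ ⊢ D
  /R     : ∀ {Γ B C} → Γ ++ [ fm B ] ⊢ C → Γ ⊢ C ／ B
  ＼L    : ∀ {Γ A Δ C D} → Γ ⊢ A → Δ ⟦ [ fm C ] ⟧ ⊢ D →
           Δ ⟦ Γ ++ [ fm (A ＼ C) ] ⟧ ⊢ D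
  ＼R    : ∀ {Γ A C} → fm A ∷ Γ ⊢ C → Γ ⊢ A ＼ C
  ·L     : ∀ {Δ A B D} → Δ ⟦ fm A ∷ fm B ∷ [] ⟧ ⊢ D → Δ ⟦ [ fm (A · B) ] ⟧ ⊢ D
  ·R     : ∀ {Γ₁ Γ₂ A B} → Γ₁ ⊢ A → Γ₂ ⊢ B → Γ₁ ++ Γ₂ ⊢ A · B
  𝟏L     : ∀ {Δ A} → Δ ⟦ Λ ⟧ ⊢ A → Δ ⟦ [ fm 𝟏 ] ⟧ ⊢ A
  ⟨⟩L    : ∀ {Δ A C} → Δ ⟦ [ br [ fm A ] ] ⟧ ⊢ C → Δ ⟦ [ fm (⟨⟩ A) ] ⟧ ⊢ C
  ⟨⟩R    : ∀ {Π A} → Π ⊢ A → [ br Π ] ⊢ ⟨⟩ A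
  []⁻¹L  : ∀ {Δ A C} → Δ ⟦ [ fm A ] ⟧ ⊢ C → Δ ⟦ [ br [ fm ([]⁻¹ A) ] ] ⟧ ⊢ C
  []⁻¹R  : ∀ {Π A} → [ br Π ] ⊢ A → Π ⊢ []⁻¹ A
  !L     : ∀ {Γ A B} → Γ ⟦ [ fm A ] ⟧ ⊢ B → Γ ⟦ [ fm (! A) ] ⟧ ⊢ B
  !R     : ∀ {As A} → bangs As ⊢ A → bangs As ⊢ ! A
  contr  : ∀ {Δ A As Γ B} →
           Δ ⟦ bangs (A ∷ As) ++ br (bangs (A ∷ As) ++ Γ) ∷ [] ⟧ ⊢ B →
           Δ ⟦ bangs (A ∷ As) ++ Γ ⟧ ⊢ B
  perm₁  : ∀ {Δ A Γ B} → Δ ⟦ fm (! A) ∷ Γ ⟧ ⊢ B → Δ ⟦ Γ ++ [ fm (! A) ] ⟧ ⊢ B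
  perm₂  : ∀ {Δ A Γ B} → Δ ⟦ Γ ++ [ fm (! A) ] ⟧ ⊢ B → Δ ⟦ fm (! A) ∷ Γ ⟧ ⊢ B
  cut    : ∀ {Π A Δ C} → Π ⊢ A → Δ ⟦ [ fm A ] ⟧ ⊢ C → Δ ⟦ Π ⟧ ⊢ C

-- [ !([]⁻¹A) ] derives A. So, after permuting !([]⁻¹A) next to A, a bracketed
-- copy of it produced by contraction can be cut against A, which absorbs A.
module Submission where

open import Defs
open import Data.List using (List; _∷_; _++_; []; [_])
open import Data.List.Properties using (++-assoc)
open import Relation.Binary.PropositionalEquality hiding ([_])
open ≡-Reasoning

++-snoc-++ : ∀ {a} {X : Set a} (L M R : List X) (x : X) →
             L ++ (M ++ [ x ]) ++ R ≡ (L ++ M) ++ x ∷ R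
++-snoc-++ L M R x = begin
  L ++ (M ++ [ x ]) ++ R  ≡⟨ cong (L ++_) (++-assoc M [ x ] R) ⟩
  L ++ M ++ x ∷ R         ≡⟨ ++-assoc L M (x ∷ R) ⟨
  (L ++ M) ++ x ∷ R       ∎

!-shiftʳ : ∀ {B C} (L M R : MF) →
           L ++ fm (! B) ∷ M ++ R ⊢ C → (L ++ M) ++ fm (! B) ∷ R ⊢ C
!-shiftʳ {B} {C} L M R d =
  subst (_⊢ C) (++-snoc-++ L M R (fm (! B))) (perm₁ {Δ = hole L R} {Γ = M} d)

!-shiftˡ : ∀ {B C} (L M R : MF) →
           (L ++ M) ++ fm (! B) ∷ R ⊢ C → L ++ fm (! B) ∷ M ++ R ⊢ C
!-shiftˡ {B} {C} L M R d =
  perm₂ {Δ = hole L R} {Γ = M} (subst (_⊢ C) (sym (++-snoc-++ L M R (fm (! B)))) d)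

![]⁻¹-⊢ : ∀ {A} → [ br [ fm (! ([]⁻¹ A)) ] ] ⊢ A
![]⁻¹-⊢ = !L {Γ = inBr [] (hole [] []) []} ([]⁻¹L {Δ = hole [] []} ax)

-- Packing !B, A into !B · A lets one cut replace it by !B, [!B], which contr collapses.
!-absorb : ∀ {Δ B A C} → [ br [ fm (! B) ] ] ⊢ A →
           Δ ⟦ fm (! B) ∷ fm A ∷ [] ⟧ ⊢ C → Δ ⟦ [ fm (! B) ] ⟧ ⊢ C
!-absorb {Δ} {B} bracketed d =
  contr {Δ = Δ} {A = B} {As = []} {Γ = []}
    (cut {Δ = Δ} (·R ax bracketed) (·L {Δ = Δ} d))

lemma7 : (Δ₁ Δ₂ Δ₃ : MF) (A C : Fm) →
    Δ₁ ++ fm (! ([]⁻¹ A)) ∷ Δ₂ ++ fm A ∷ Δ₃ ⊢ C →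
    Δ₁ ++ fm (! ([]⁻¹ A)) ∷ Δ₂ ++ Δ₃ ⊢ C
lemma7 Δ₁ Δ₂ Δ₃ A C d =
  !-shiftˡ Δ₁ Δ₂ Δ₃
    (!-absorb {Δ = hole (Δ₁ ++ Δ₂) Δ₃} ![]⁻¹-⊢
      (!-shiftʳ Δ₁ Δ₂ (fm A ∷ Δ₃) d))
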